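{- Let $q$ be a prime power, $m,k$ positive integers and $\rho\in\{1,\ldots,\min\{k,m\}\}$. Let $G'\in\mathbb{F}_{q^m}^{(k-\rho)\times m(k-\rho)}$ be a matrix whose columns are $\mathbb{F}_q$-linearly independent, and let $\mathcal{U}$ be the $[m(k-\rho)+\rho,k]_{q^m/q}$ system spanned over $\mathbb{F}_q$ by the columns of \[G=\begin{pmatrix} I_\rho & 0\\ 0 & G'\end{pmatrix}.\] Then $\mathcal{U}$ is rank-$\rho$-saturating. In particular, $s_{q^m/q}(k,\rho)\le m(k-\rho)+\rho$.
   Context: An $[n,k]_{q^m/q}$ system is an $n$-dimensional $\mathbb{F}_q$-subspace $\mathcal{U}\le\mathbb{F}_{q^m}^k$ with $\langle\mathcal{U}\rangle_{\mathbb{F}_{q^m}}=\mathbb{F}_{q^m}^k$; a generator matrix is a $k\times n$ matrix whose columns form an $\mathbb{F}_q$-basis of $\mathcal{U}$. Its linear set is $L_\mathcal{U}=\{\langle u\rangle_{\mathbb{F}_{q^m}}:u\in\mathcal{U}\setminus\{0\}\}\subseteq\mathrm{PG}(k-1,q^m)$. A point set $\mathcal{S}$ of $\mathrm{PG}(k-1,q^m)$ is $r$-saturating if every point lies in the span of some $r+1$ points of $\mathcal{S}$ and $r$ is minimal with this property; $\mathcal{U}$ is rank-$\rho$-saturating if $L_\mathcal{U}$ is $(\rho-1)$-saturating. For $\rho\in\{1,\ldots,\min\{k,m\}\}$, $s_{q^m/q}(k,\rho)$ denotes the minimum $n$ such that an $[n,k]_{q^m/q}$ rank-$\rho$-saturating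 system exists. -}

module Defs where

open import Level using (0ℓ)
open import Data.Nat using (ℕ; zero; suc; _∸_; _<_; _≤_) renaming (_+_ to _+ℕ_; _*_ to _*ℕ_; _^_ to _^ℕ_)
open import Data.Nat.Properties using (m+[n∸m]≡n)
open import Data.Nat.Primality using (Prime)
open import Data.Fin using (Fin; zero; suc; splitAt; cast) renaming (_≟_ to _≟F_)
open import Data.Sum using (_⊎_; inj₁; inj₂)
open import Data.Product using (Σ; ∃; _×_; _,_)
open import Relation.Nullary using (¬_; yes; no)
open import Relation.Binary.PropositionalEquality using (_≡_)
open import Algebra.Structures using (IsCommutativeRing)
open import Function.Bundles using (_↔_)

record Field : Set₁ where
  infixl 6 _+_
  infixl 7 _*_
  field
    Carrier : Set
    _+_ _*_ : Carrier → Carrier → Carrier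
    -_      : Carrier → Carrier
    0# 1#   : Carrier
    isCommutativeRing : IsCommutativeRing _≡_ _+_ _*_ -_ 0# 1#
    0≢1     : ¬ (0# ≡ 1#)
    inverse : ∀ x → ¬ (x ≡ 0#) → ∃ λ y → x * y ≡ 1#

open Field

-- An extension of fields: Fq ↪ L via a (necessarily injective) ring homomorphism.
record Extension : Set₁ where
  field
    Fq L : Field
    ι    : Carrier Fq → Carrier L
    ι-+  : ∀ a b → ι (_+_ Fq a b) ≡ _+_ L (ι a) (ι b)
    ι-*  : ∀ a b → ι (_*_ Fq a b) ≡ _*_ L (ι a) (ι b)
    ι-1  : ι (1# Fq) ≡ 1# L

IsPrimePower : ℕ → Set
IsPrimePower q = ∃ λ p → ∃ λ e → Prime p × 1 ≤ e × q ≡ p ^ℕ e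

∑ : (K : Field) {n : ℕ} → (Fin n → Carrier K) → Carrier K
∑ K {zero}  f = 0# K
∑ K {suc n} f = _+_ K (f zero) (∑ K (λ i → f (suc i)))

Vect : Field → ℕ → Set
Vect K k = Fin k → Carrier K

Mat : Field → ℕ → ℕ → Set
Mat K k n = Fin k → Fin n → Carrier K

Nonzero : (K : Field) {k : ℕ} → Vect K k → Set
Nonzero K v = ¬ (∀ r → v r ≡ 0# K)

module _ (E : Extension) where
  open Extension E

  -- [L : Fq] = m : there is an Fq-basis of L with m elements
  HasDegree : ℕ → Set
  HasDegree m = Σ (Fin m → Carrier L) λ b →
      (∀ x → ∃ λ (λs : Fin m → Carrier Fq) → x ≡ ∑ L (λ i → _*_ L (ι (λs i)) (b i)))
    × (∀ (λs : Fin m → Carrier Fq) → ∑ L (λ i → _*_ L (ι (λs i)) (b i)) ≡ 0# L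
         → ∀ i → λs i ≡ 0# Fq)

  Fcomb : {k n : ℕ} → Mat L k n → (Fin n → Carrier Fq) → Vect L k
  Fcomb M λs r = ∑ L (λ j → _*_ L (ι (λs j)) (M r j))

  ColsFIndep : {k n : ℕ} → Mat L k n → Set
  ColsFIndep M = ∀ λs → (∀ r → Fcomb M λs r ≡ 0# L) → ∀ j → λs j ≡ 0# Fq

  InU : {k n : ℕ} → Mat L k n → Vect L k → Set
  InU M v = ∃ λ λs → ∀ r → v r ≡ Fcomb M λs r

  LSpans : {k n : ℕ} → Mat L k n → Set
  LSpans {k} M = ∀ (v : Vect L k) → ∃ λ (μ : Fin _ → Carrier L) →
      ∀ r → v r ≡ ∑ L (λ j → _*_ L (μ j) (M r j))

  IsSystem : {k n : ℕ} → Mat L k n → Set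
  IsSystem M = ColsFIndep M × LSpans M

  -- every point of PG(k-1, q^m) lies in the span of some s points of L_U
  -- (points of L_U represented by nonzero vectors of U)
  Covered : {k n : ℕ} → Mat L k n → ℕ → Set
  Covered {k} M s = ∀ (v : Vect L k) → Nonzero L v →
    ∃ λ (u : Fin s → Vect L k) → (∀ i → InU M (u i) × Nonzero L (u i)) ×
      ∃ λ (μ : Fin s → Carrier L) → ∀ r → v r ≡ ∑ L (λ i → _*_ L (μ i) (u i r))

  Saturating : {k n : ℕ} → Mat L k n → ℕ → Set
  Saturating M r = Covered M (suc r) × (∀ r' → r' < r → ¬ Covered M (suc r'))

  RankSaturating : {k n : ℕ} → Mat L k n → ℕ → Set
  RankSaturating M ρ = ∃ λ r → ρ ≡ suc r × Saturating M r

  sLe : (k ρ N : ℕ) → Set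
  sLe k ρ N = ∃ λ n → n ≤ N × Σ (Mat L k n) λ M → IsSystem M × RankSaturating M ρ

  idEntry : {ρ : ℕ} → Fin ρ → Fin ρ → Carrier L
  idEntry a b with a ≟F b
  ... | yes _ = 1# L
  ... | no  _ = 0# L

  -- G = ( I_ρ 0 ; 0 G' ), a k × (ρ + m(k-ρ)) matrix
  blockG : {k ρ : ℕ} (m : ℕ) → ρ ≤ k → Mat L (k ∸ ρ) (m *ℕ (k ∸ ρ)) →
           Mat L k (ρ +ℕ m *ℕ (k ∸ ρ))
  blockG {k} {ρ} m ρ≤k G' i j with splitAt ρ (cast (Relation.Binary.PropositionalEquality.sym (m+[n∸m]≡n ρ≤k)) i) | splitAt ρ j
  ... | inj₁ a | inj₁ b = idEntry a b
  ... | inj₁ a | inj₂ b = 0# L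
  ... | inj₂ a | inj₁ b = 0# L
  ... | inj₂ a | inj₂ b = G' a b

-- Let U be the F_q-span of the columns of G. The m(k−ρ) columns of G' are F_q-independent in F_{q^m}^{k−ρ},
-- an F_q-space of dimension m(k−ρ), so they span it; hence U consists of all vectors whose first ρ entries lie
-- in F_q, and in particular U spans F_{q^m}^k. A nonzero v is an F_{q^m}-combination of ρ nonzero vectors of U:
-- if some upper entry v_{a₀} is nonzero, take u_i = e_i + δ_{i a₀} v_{a₀}⁻¹ (0, v_lower) with coefficients v_i;
-- otherwise v ∈ U already. Fewer points never suffice: if v = (b_1, …, b_ρ, 0) with b_1, …, b_ρ part of an F_q-basis
-- of F_{q^m} were a combination of s < ρ vectors of U, the s upper parts, vectors of F_q^ρ, would satisfy a common
-- nonzero F_q-relation d, and then Σ d_a b_a = 0. Every dependence used is found by counting: an F_q-linear map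
-- F_q^n → F_q^s with s < n is not injective, since q^s < q^n.

module Submission where

open import Level using (0ℓ)
open import Data.Nat using (ℕ; zero; suc; _∸_; _^_; s≤s; z≤n)
  renaming (_+_ to _+ℕ_; _*_ to _*ℕ_; _≤_ to _≤ℕ_; _<_ to _<ℕ_)
open import Data.Nat.Properties using (^-monoʳ-<; n<1+n; m+[n∸m]≡n; ≤-reflexive; +-comm)
open import Data.Fin
  using (Fin; zero; suc; _↑ˡ_; _↑ʳ_; splitAt; cast; inject≤; fromℕ<; funToFin; finToFun; combine; remQuot)
open import Data.Fin.Properties
  using (suc-injective; ¬Fin0; cast-involutive; splitAt-↑ˡ; splitAt-↑ʳ; funToFin-finToFin; finToFun-funToFin;
         remQuot-combine; pigeonhole; <⇒≢; all?; ¬∀⟶∃¬)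
open import Data.Sum using (_⊎_; inj₁; inj₂; [_,_])
open import Data.Product using (∃; ∃₂; _×_; _,_; proj₁; proj₂)
open import Data.Vec.Functional using (_∷_; _++_)
open import Data.Vec.Functional.Properties using (lookup-++ˡ; lookup-++ʳ)
open import Data.Empty using (⊥-elim)
open import Function using (_∘_)
open import Function.Bundles using (_↔_; Inverse)
open import Function.Properties.Inverse using (↔-sym; ↔⇒↣)
open import Relation.Nullary using (¬_; Dec; yes; no)
open import Relation.Nullary.Decidable using (via-injection)
open import Relation.Binary.Definitions using (DecidableEquality)
open import Relation.Binary.PropositionalEquality hiding ([_])
open import Algebra.Bundles using (CommutativeRing)
import Algebra.Properties.Ring as RingProperties
import Algebra.Properties.CommutativeSemigroup as CommutativeSemigroupProperties
open import Defs

↑-elim : ∀ {m n} (P : Fin (m +ℕ n) → Set) → (∀ i → P (i ↑ˡ n)) → (∀ j → P (m ↑ʳ j)) → ∀ i → P i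
↑-elim {zero}  P Pˡ Pʳ i       = Pʳ i
↑-elim {suc m} P Pˡ Pʳ zero    = Pˡ zero
↑-elim {suc m} P Pˡ Pʳ (suc i) = ↑-elim (P ∘ suc) (Pˡ ∘ suc) Pʳ i

module RowSplit {ρ k : ℕ} (ρ≤k : ρ ≤ℕ k) where
  ρ+[k∸ρ]≡k : ρ +ℕ (k ∸ ρ) ≡ k
  ρ+[k∸ρ]≡k = m+[n∸m]≡n ρ≤k

  split : Fin k → Fin ρ ⊎ Fin (k ∸ ρ)
  split i = splitAt ρ (cast (sym ρ+[k∸ρ]≡k) i)

  upper : Fin ρ → Fin k
  upper a = cast ρ+[k∸ρ]≡k (a ↑ˡ (k ∸ ρ))

  lower : Fin (k ∸ ρ) → Fin k
  lower c = cast ρ+[k∸ρ]≡k (ρ ↑ʳ c)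

  split-upper : ∀ a → split (upper a) ≡ inj₁ a
  split-upper a = trans (cong (splitAt ρ) (cast-involutive (sym ρ+[k∸ρ]≡k) ρ+[k∸ρ]≡k _)) (splitAt-↑ˡ ρ a (k ∸ ρ))

  split-lower : ∀ c → split (lower c) ≡ inj₂ c
  split-lower c = trans (cong (splitAt ρ) (cast-involutive (sym ρ+[k∸ρ]≡k) ρ+[k∸ρ]≡k _)) (splitAt-↑ʳ ρ (k ∸ ρ) c)

  row-elim : (P : Fin k → Set) → (∀ a → P (upper a)) → (∀ c → P (lower c)) → ∀ i → P i
  row-elim P Pᵘ Pˡ i =
    subst P (cast-involutive ρ+[k∸ρ]≡k (sym ρ+[k∸ρ]≡k) i) (↑-elim (P ∘ cast ρ+[k∸ρ]≡k) Pᵘ Pˡ (cast (sym ρ+[k∸ρ]≡k) i))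

  glue : {A : Set} → (Fin ρ → A) → (Fin (k ∸ ρ) → A) → Fin k → A
  glue t b = [ t , b ] ∘ split

  glue-upper : ∀ {A : Set} (t : Fin ρ → A) b a → glue t b (upper a) ≡ t a
  glue-upper t b a = cong [ t , b ] (split-upper a)

  glue-lower : ∀ {A : Set} (t : Fin ρ → A) b c → glue t b (lower c) ≡ b c
  glue-lower t b c = cong [ t , b ] (split-lower c)

funToFin-cong : ∀ {m n} {f g : Fin m → Fin n} → (∀ i → f i ≡ g i) → funToFin f ≡ funToFin g
funToFin-cong {zero}  f≗g = refl
funToFin-cong {suc m} f≗g = cong₂ combine (f≗g zero) (funToFin-cong (f≗g ∘ suc))

module FieldProperties (K : Field) where
  open Field K

  commutativeRing : CommutativeRing 0ℓ 0ℓ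
  commutativeRing = record
    { Carrier = Carrier ; _≈_ = _≡_ ; _+_ = _+_ ; _*_ = _*_ ; -_ = -_ ; 0# = 0# ; 1# = 1#
    ; isCommutativeRing = isCommutativeRing }

  open CommutativeRing commutativeRing public
    using ( +-assoc; +-identityˡ; +-identityʳ; -‿inverseʳ
          ; *-assoc; *-comm; *-identityˡ; *-identityʳ; distribˡ; zeroˡ; zeroʳ)
  open RingProperties (CommutativeRing.ring commutativeRing) public
    using (-‿involutive; -‿distribˡ-*; -‿distribʳ-*; -1*x≈-x; [y-z]x≈yx-zx
          ; +-identityʳ-unique; +-inverseʳ-unique; x∙y⁻¹≈ε⇒x≈y; x≈y⇒x∙y⁻¹≈ε)
  open CommutativeSemigroupProperties (CommutativeRing.+-commutativeSemigroup commutativeRing) public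
    using (interchange)
  open CommutativeSemigroupProperties (CommutativeRing.*-commutativeSemigroup commutativeRing) public
    using (x∙yz≈y∙xz)
  open ≡-Reasoning

  -x*-y≡x*y : ∀ x y → - x * - y ≡ x * y
  -x*-y≡x*y x y = begin
    - x * - y      ≡⟨ -‿distribʳ-* (- x) y ⟨
    - (- x * y)    ≡⟨ cong -_ (-‿distribˡ-* x y) ⟨
    - (- (x * y))  ≡⟨ -‿involutive (x * y) ⟩
    x * y          ∎

  ∑-cong : ∀ {n} {f g : Fin n → Carrier} → (∀ i → f i ≡ g i) → ∑ K f ≡ ∑ K g
  ∑-cong {zero}  f≗g = refl
  ∑-cong {suc n} f≗g = cong₂ _+_ (f≗g zero) (∑-cong (f≗g ∘ suc))

  ∑-zero : ∀ {n} {f : Fin n → Carrier} → (∀ i → f i ≡ 0#) → ∑ K f ≡ 0#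
  ∑-zero {zero}  f≗0 = refl
  ∑-zero {suc n} f≗0 = trans (cong₂ _+_ (f≗0 zero) (∑-zero (f≗0 ∘ suc))) (+-identityˡ 0#)

  ∑-distrib-+ : ∀ {n} (f g : Fin n → Carrier) → ∑ K (λ i → f i + g i) ≡ ∑ K f + ∑ K g
  ∑-distrib-+ {zero}  f g = sym (+-identityˡ 0#)
  ∑-distrib-+ {suc n} f g =
    trans (cong (f zero + g zero +_) (∑-distrib-+ (f ∘ suc) (g ∘ suc))) (interchange _ _ _ _)

  *-distribˡ-∑ : ∀ {n} c (f : Fin n → Carrier) → c * ∑ K f ≡ ∑ K (λ i → c * f i)
  *-distribˡ-∑ {zero}  c f = zeroʳ c
  *-distribˡ-∑ {suc n} c f = trans (distribˡ c (f zero) _) (cong (c * f zero +_) (*-distribˡ-∑ c (f ∘ suc)))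

  -‿distrib-∑ : ∀ {n} (f : Fin n → Carrier) → - ∑ K f ≡ ∑ K (λ i → - f i)
  -‿distrib-∑ f = begin
    - ∑ K f                  ≡⟨ -1*x≈-x _ ⟨
    - 1# * ∑ K f             ≡⟨ *-distribˡ-∑ (- 1#) f ⟩
    ∑ K (λ i → - 1# * f i)   ≡⟨ ∑-cong (λ i → -1*x≈-x (f i)) ⟩
    ∑ K (λ i → - f i)        ∎

  ∑-sub : ∀ {n} (f g : Fin n → Carrier) → ∑ K (λ i → f i + - g i) ≡ ∑ K f + - ∑ K g
  ∑-sub f g = trans (∑-distrib-+ f (λ i → - g i)) (cong (∑ K f +_) (sym (-‿distrib-∑ g)))

  ∑-comm : ∀ {m n} (f : Fin m → Fin n → Carrier) →
           ∑ K (λ i → ∑ K (f i)) ≡ ∑ K (λ j → ∑ K (λ i → f i j))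
  ∑-comm {zero} {n} f = sym (∑-zero {n} (λ _ → refl))
  ∑-comm {suc m} {n} f =
    trans (cong (∑ K (f zero) +_) (∑-comm (f ∘ suc))) (sym (∑-distrib-+ (f zero) _))

  ∑-↑ : ∀ {m n} (f : Fin (m +ℕ n) → Carrier) → ∑ K f ≡ ∑ K (λ i → f (i ↑ˡ n)) + ∑ K (λ j → f (m ↑ʳ j))
  ∑-↑ {zero}  f = sym (+-identityˡ _)
  ∑-↑ {suc m} {n} f = trans (cong (f zero +_) (∑-↑ {m} {n} (f ∘ suc))) (sym (+-assoc _ _ _))

  ∑-single : ∀ {n} (f : Fin n → Carrier) i → (∀ j → j ≢ i → f j ≡ 0#) → ∑ K f ≡ f i
  ∑-single f zero    f≡0 = trans (cong (f zero +_) (∑-zero (λ j → f≡0 (suc j) λ ()))) (+-identityʳ _)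
  ∑-single f (suc i) f≡0 =
    trans (cong₂ _+_ (f≡0 zero λ ()) (∑-single (f ∘ suc) i (λ j j≢i → f≡0 (suc j) (j≢i ∘ suc-injective))))
          (+-identityˡ _)

1<card : (K : Field) {q : ℕ} → Fin q ↔ Field.Carrier K → 1 <ℕ q
1<card K {zero}        enum = ⊥-elim (¬Fin0 (Inverse.from enum (Field.0# K)))
1<card K {suc zero}    enum = ⊥-elim (Field.0≢1 K (begin
    0#            ≡⟨ strictlyInverseˡ 0# ⟨
    to (from 0#)  ≡⟨ cong to (Fin1-singleton (from 0#) (from 1#)) ⟩
    to (from 1#)  ≡⟨ strictlyInverseˡ 1# ⟩
    1#            ∎))
  where
  open Field K using (0#; 1#)
  open Inverse enum using (to; from; strictlyInverseˡ)
  open ≡-Reasoning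
  Fin1-singleton : (i j : Fin 1) → i ≡ j
  Fin1-singleton zero zero = refl
1<card K {suc (suc q)} enum = s≤s (s≤s z≤n)

module FiniteField (K : Field) {q : ℕ} (enum : Fin q ↔ Field.Carrier K) where
  open Field K
  open FieldProperties K
  open Inverse enum using (to; from; strictlyInverseˡ; strictlyInverseʳ)
  open ≡-Reasoning

  _≟_ : DecidableEquality Carrier
  _≟_ = via-injection (↔⇒↣ (↔-sym enum)) Data.Fin._≟_

  encode : ∀ {n} → (Fin n → Carrier) → Fin (q ^ n)
  encode f = funToFin (from ∘ f)

  decode : ∀ {n} → Fin (q ^ n) → Fin n → Carrier
  decode x = to ∘ finToFun x

  decode-encode : ∀ {n} (f : Fin n → Carrier) → ∀ a → decode (encode f) a ≡ f a
  decode-encode f a = trans (cong to (finToFun-funToFin (from ∘ f) a)) (strictlyInverseˡ (f a))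

  decode-injective : ∀ {n} {x y : Fin (q ^ n)} → (∀ a → decode x a ≡ decode y a) → x ≡ y
  decode-injective {n} {x} {y} x≗y = begin
    x                              ≡⟨ funToFin-finToFin {n} x ⟨
    funToFin (finToFun {q} {n} x)  ≡⟨ funToFin-cong {n} {q} (λ a →
                                        trans (sym (strictlyInverseʳ _)) (trans (cong from (x≗y a)) (strictlyInverseʳ _))) ⟩
    funToFin (finToFun {q} {n} y)  ≡⟨ funToFin-finToFin {n} y ⟩
    y                              ∎

  vector-pigeonhole : ∀ {s n} → s <ℕ n → (Φ : (Fin n → Carrier) → Fin s → Carrier) →
    ∃₂ λ c c' → ¬ (∀ a → c a ≡ c' a) × (∀ i → Φ c i ≡ Φ c' i)
  vector-pigeonhole {s} {n} s<n Φ with pigeonhole (^-monoʳ-< q (1<card K enum) s<n) (encode ∘ Φ ∘ decode)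
  ... | x , y , x<y , Φx≡Φy =
    decode x , decode y , <⇒≢ x<y ∘ decode-injective {n} , λ i → begin
      Φ (decode x) i                     ≡⟨ decode-encode (Φ (decode x)) i ⟨
      decode (encode (Φ (decode x))) i   ≡⟨ cong (λ z → decode z i) Φx≡Φy ⟩
      decode (encode (Φ (decode y))) i   ≡⟨ decode-encode (Φ (decode y)) i ⟩
      Φ (decode y) i                     ∎

  nontrivial-kernel : ∀ {s n} → s <ℕ n → (A : Mat K s n) →
    ∃ λ d → Nonzero K d × (∀ i → ∑ K (λ a → d a * A i a) ≡ 0#)
  nontrivial-kernel {s} {n} s<n A with vector-pigeonhole s<n (λ c i → ∑ K (λ a → c a * A i a))
  ... | c , c' , c≢c' , Ac≡Ac' =
    (λ a → c a + - c' a) , (λ d≡0 → c≢c' (λ a → x∙y⁻¹≈ε⇒x≈y _ _ (d≡0 a))) , λ i → begin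
    ∑ K (λ a → (c a + - c' a) * A i a)                    ≡⟨ ∑-cong (λ a → [y-z]x≈yx-zx (A i a) (c a) (c' a)) ⟩
    ∑ K (λ a → c a * A i a + - (c' a * A i a))            ≡⟨ ∑-sub {n} _ _ ⟩
    ∑ K (λ a → c a * A i a) + - ∑ K (λ a → c' a * A i a)  ≡⟨ x≈y⇒x∙y⁻¹≈ε (Ac≡Ac' i) ⟩
    0#                                                    ∎

module FiniteExtension (E : Extension) {q : ℕ} (enum : Fin q ↔ Field.Carrier (Extension.Fq E)) where
  open Extension E
  open Field L
  open FieldProperties L
  module F = Field Fq
  module F′ = FieldProperties Fq
  open FiniteField Fq enum using (_≟_; nontrivial-kernel)
  open ≡-Reasoning

  ι-0 : ι F.0# ≡ 0#
  ι-0 = +-identityʳ-unique (ι F.0#) (ι F.0#) (begin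
    ι F.0# + ι F.0#   ≡⟨ ι-+ F.0# F.0# ⟨
    ι (F.0# F.+ F.0#) ≡⟨ cong ι (F′.+-identityʳ F.0#) ⟩
    ι F.0#            ∎)

  ι-0-* : ∀ x → ι F.0# * x ≡ 0#
  ι-0-* x = trans (cong (_* x) ι-0) (zeroˡ x)

  ι-0-*ʳ : ∀ x → x * ι F.0# ≡ 0#
  ι-0-*ʳ x = trans (cong (x *_) ι-0) (zeroʳ x)

  ι-neg : ∀ a → ι (F.- a) ≡ - ι a
  ι-neg a = +-inverseʳ-unique (ι a) (ι (F.- a)) (begin
    ι a + ι (F.- a)   ≡⟨ ι-+ a (F.- a) ⟨
    ι (a F.+ F.- a)   ≡⟨ cong ι (F′.-‿inverseʳ a) ⟩
    ι F.0#            ≡⟨ ι-0 ⟩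
    0#                ∎)

  ι-∑ : ∀ {n} (f : Fin n → F.Carrier) → ι (∑ Fq f) ≡ ∑ L (ι ∘ f)
  ι-∑ {zero}  f = ι-0
  ι-∑ {suc n} f = trans (ι-+ _ _) (cong (ι (f zero) +_) (ι-∑ (f ∘ suc)))

  ι-injective₀ : ∀ {a} → ι a ≡ 0# → a ≡ F.0#
  ι-injective₀ {a} ιa≡0 with a ≟ F.0#
  ... | yes a≡0 = a≡0
  ... | no  a≢0 with F.inverse a a≢0
  ...   | b , ab≡1 = ⊥-elim (0≢1 (begin
    0#           ≡⟨ zeroˡ (ι b) ⟨
    0# * ι b     ≡⟨ cong (_* ι b) ιa≡0 ⟨
    ι a * ι b    ≡⟨ ι-* a b ⟨
    ι (a F.* b)  ≡⟨ cong ι ab≡1 ⟩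
    ι F.1#       ≡⟨ ι-1 ⟩
    1#           ∎))

  Fcomb-scale : ∀ {k n} (M : Mat L k n) a λs r → Fcomb E M (λ j → a F.* λs j) r ≡ ι a * Fcomb E M λs r
  Fcomb-scale {n = n} M a λs r = begin
    ∑ L (λ j → ι (a F.* λs j) * M r j)   ≡⟨ ∑-cong (λ j → trans (cong (_* M r j) (ι-* a (λs j))) (*-assoc _ _ _)) ⟩
    ∑ L (λ j → ι a * (ι (λs j) * M r j)) ≡⟨ *-distribˡ-∑ {n} (ι a) _ ⟨
    ι a * Fcomb E M λs r                 ∎

  ι-relation-lifts : ∀ {s n} (d : Fin n → F.Carrier) (A : Mat Fq s n) (c : Fin s → Carrier) →
    (∀ i → ∑ Fq (λ a → d a F.* A i a) ≡ F.0#) →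
    ∑ L (λ a → ι (d a) * ∑ L (λ i → c i * ι (A i a))) ≡ 0#
  ι-relation-lifts {s} {n} d A c dA≡0 = begin
    ∑ L (λ a → ι (d a) * ∑ L (λ i → c i * ι (A i a)))    ≡⟨ ∑-cong (λ a → *-distribˡ-∑ {s} (ι (d a)) _) ⟩
    ∑ L (λ a → ∑ L (λ i → ι (d a) * (c i * ι (A i a))))  ≡⟨ ∑-comm {n} {s} _ ⟩
    ∑ L (λ i → ∑ L (λ a → ι (d a) * (c i * ι (A i a))))  ≡⟨ ∑-cong (λ i → ∑-cong (λ a → swap i a)) ⟩
    ∑ L (λ i → ∑ L (λ a → c i * ι (d a F.* A i a)))      ≡⟨ ∑-cong (λ i → *-distribˡ-∑ {n} (c i) _) ⟨
    ∑ L (λ i → c i * ∑ L (λ a → ι (d a F.* A i a)))      ≡⟨ ∑-cong (λ i → cong (c i *_) (ι-∑ {n} _)) ⟨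
    ∑ L (λ i → c i * ι (∑ Fq (λ a → d a F.* A i a)))     ≡⟨ ∑-zero (λ i → trans (cong (λ x → c i * ι x) (dA≡0 i)) (ι-0-*ʳ (c i))) ⟩
    0#                                                   ∎
    where
    swap : ∀ i a → ι (d a) * (c i * ι (A i a)) ≡ c i * ι (d a F.* A i a)
    swap i a = trans (x∙yz≈y∙xz _ _ _) (cong (c i *_) (sym (ι-* (d a) (A i a))))

  spannedByFewer⇒dependent : ∀ {s n} → s <ℕ n → (A : Mat Fq s n) (c : Fin s → Carrier) (w : Fin n → Carrier) →
    (∀ a → w a ≡ ∑ L (λ i → c i * ι (A i a))) →
    ∃ λ d → Nonzero Fq d × ∑ L (λ a → ι (d a) * w a) ≡ 0#
  spannedByFewer⇒dependent s<n A c w w≡cA with nontrivial-kernel s<n A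
  ... | d , d≢0 , dA≡0 = d , d≢0 , trans (∑-cong (λ a → cong (ι (d a) *_) (w≡cA a))) (ι-relation-lifts d A c dA≡0)

  δ : ∀ {n} → Fin n → Fin n → F.Carrier
  δ a b with a Data.Fin.≟ b
  ... | yes _ = F.1#
  ... | no  _ = F.0#

  ι-δ : ∀ {n} (a b : Fin n) → ι (δ a b) ≡ idEntry E a b
  ι-δ a b with a Data.Fin.≟ b
  ... | yes _ = ι-1
  ... | no  _ = ι-0

  idEntry-diag : ∀ {n} (a : Fin n) → idEntry E a a ≡ 1#
  idEntry-diag a with a Data.Fin.≟ a
  ... | yes _   = refl
  ... | no  a≢a = ⊥-elim (a≢a refl)

  idEntry-offdiag : ∀ {n} {a b : Fin n} → a ≢ b → idEntry E a b ≡ 0#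
  idEntry-offdiag {a = a} {b} a≢b with a Data.Fin.≟ b
  ... | yes a≡b = ⊥-elim (a≢b a≡b)
  ... | no  _   = refl

  ∑-idEntry : ∀ {n} (f : Fin n → Carrier) a → ∑ L (λ b → f b * idEntry E a b) ≡ f a
  ∑-idEntry f a = begin
    ∑ L (λ b → f b * idEntry E a b)  ≡⟨ ∑-single _ a (λ b b≢a → trans (cong (f b *_) (idEntry-offdiag (b≢a ∘ sym))) (zeroʳ _)) ⟩
    f a * idEntry E a a              ≡⟨ cong (f a *_) (idEntry-diag a) ⟩
    f a * 1#                         ≡⟨ *-identityʳ (f a) ⟩
    f a                              ∎

  CoveredBy : ∀ {k n} → Mat L k n → ℕ → Vect L k → Set
  CoveredBy {k} M s v = ∃ λ (u : Fin s → Vect L k) → (∀ i → InU E M (u i) × Nonzero L (u i)) ×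
    ∃ λ (μ : Fin s → Carrier) → ∀ r → v r ≡ ∑ L (λ i → μ i * u i r)

  InU⇒coveredBy : ∀ {k n s} {M : Mat L k n} {v : Vect L k} → Fin s → InU E M v → Nonzero L v → CoveredBy M s v
  InU⇒coveredBy {s = s} {v = v} i₀ v∈U v≢0 = (λ _ → v) , (λ _ → v∈U , v≢0) , idEntry E i₀ , λ r → begin
    v r                                 ≡⟨ ∑-idEntry (λ _ → v r) i₀ ⟨
    ∑ L (λ i → v r * idEntry E i₀ i)    ≡⟨ ∑-cong {s} (λ i → *-comm (v r) _) ⟩
    ∑ L (λ i → idEntry E i₀ i * v r)    ∎

  module Coordinates {m : ℕ} (hd : HasDegree E m) where
    basis : Fin m → Carrier
    basis = proj₁ hd

    coord : Carrier → Fin m → F.Carrier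
    coord x = proj₁ (proj₁ (proj₂ hd) x)

    coord-spec : ∀ x → x ≡ ∑ L (λ i → ι (coord x i) * basis i)
    coord-spec x = proj₂ (proj₁ (proj₂ hd) x)

    basis-independent : ∀ λs → ∑ L (λ i → ι (λs i) * basis i) ≡ 0# → ∀ i → λs i ≡ F.0#
    basis-independent = proj₂ (proj₂ hd)

    _≟0 : ∀ x → Dec (x ≡ 0#)
    x ≟0 with all? (λ i → coord x i ≟ F.0#)
    ... | yes coord≡0 = yes (trans (coord-spec x) (∑-zero (λ i → trans (cong (λ c → ι c * basis i) (coord≡0 i)) (ι-0-* (basis i)))))
    ... | no  coord≢0 = no (λ x≡0 → coord≢0 (basis-independent (coord x) (trans (sym (coord-spec x)) x≡0)))

    -- Row (combine i r) holds the i-th F_q-coordinates of the entries of row r of M.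
    coordinateMatrix : ∀ {K n} → Mat L K n → Mat Fq (m *ℕ K) n
    coordinateMatrix {K} M x j = coord (M (proj₂ (remQuot {m} K x)) j) (proj₁ (remQuot {m} K x))

    coordinateMatrix-combine : ∀ {K n} (M : Mat L K n) i r j → coordinateMatrix M (combine i r) j ≡ coord (M r j) i
    coordinateMatrix-combine {K} M i r j = cong (λ p → coord (M (proj₂ p) j) (proj₁ p)) (remQuot-combine {m} {K} i r)

    wide⇒dependent : ∀ {K n} → m *ℕ K <ℕ n → (M : Mat L K n) →
      ∃ λ d → Nonzero Fq d × (∀ r → Fcomb E M d r ≡ 0#)
    wide⇒dependent {K} {n} mK<n M with nontrivial-kernel mK<n (coordinateMatrix M)
    ... | d , d≢0 , d-kernel = d , d≢0 , λ r →
      trans (∑-cong (λ j → cong (ι (d j) *_) (expand (M r j))))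
            (ι-relation-lifts d (λ i j → coord (M r j) i) basis (λ i →
              trans (F′.∑-cong (λ j → cong (d j F.*_) (sym (coordinateMatrix-combine M i r j)))) (d-kernel (combine i r))))
      where
      expand : ∀ x → x ≡ ∑ L (λ i → basis i * ι (coord x i))
      expand x = trans (coord-spec x) (∑-cong (λ i → *-comm _ (basis i)))

    independent⇒spanning : ∀ {K} (G : Mat L K (m *ℕ K)) → ColsFIndep E G → ∀ z → InU E G z
    independent⇒spanning {K} G G-independent z with wide⇒dependent (n<1+n (m *ℕ K)) (λ r → z r ∷ G r)
    ... | d , d≢0 , relation with d zero ≟ F.0#
    ...   | yes d₀≡0 = ⊥-elim (d≢0 d≡0)
      where
      tail-relation : ∀ r → Fcomb E G (d ∘ suc) r ≡ 0#
      tail-relation r = begin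
        Fcomb E G (d ∘ suc) r                     ≡⟨ +-identityˡ _ ⟨
        0# + Fcomb E G (d ∘ suc) r                ≡⟨ cong (_+ Fcomb E G (d ∘ suc) r) (ι-0-* (z r)) ⟨
        ι F.0# * z r + Fcomb E G (d ∘ suc) r      ≡⟨ cong (λ c → ι c * z r + Fcomb E G (d ∘ suc) r) d₀≡0 ⟨
        ι (d zero) * z r + Fcomb E G (d ∘ suc) r  ≡⟨ relation r ⟩
        0#                                        ∎
      d≡0 : ∀ j → d j ≡ F.0#
      d≡0 zero    = d₀≡0
      d≡0 (suc j) = G-independent (d ∘ suc) tail-relation j
    ...   | no d₀≢0 with F.inverse (d zero) d₀≢0
    ...     | e , d₀e≡1 = (λ j → F.- e F.* d (suc j)) , λ r → sym (begin
        Fcomb E G (λ j → F.- e F.* d (suc j)) r  ≡⟨ Fcomb-scale G (F.- e) (d ∘ suc) r ⟩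
        ι (F.- e) * Fcomb E G (d ∘ suc) r        ≡⟨ cong₂ _*_ (ι-neg e) (+-inverseʳ-unique _ _ (relation r)) ⟩
        - ι e * - (ι (d zero) * z r)             ≡⟨ -x*-y≡x*y (ι e) _ ⟩
        ι e * (ι (d zero) * z r)                 ≡⟨ *-assoc _ _ _ ⟨
        ι e * ι (d zero) * z r                   ≡⟨ cong (_* z r) (ι-* e (d zero)) ⟨
        ι (e F.* d zero) * z r                   ≡⟨ cong (λ c → ι c * z r) (trans (F′.*-comm e (d zero)) d₀e≡1) ⟩
        ι F.1# * z r                             ≡⟨ cong (_* z r) ι-1 ⟩
        1# * z r                                 ≡⟨ *-identityˡ (z r) ⟩
        z r                                      ∎)

    extendByZero : ∀ {a b} → a ≤ℕ b → (Fin a → F.Carrier) → Fin b → F.Carrier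
    extendByZero z≤n       d j       = F.0#
    extendByZero (s≤s a≤b) d zero    = d zero
    extendByZero (s≤s a≤b) d (suc j) = extendByZero a≤b (d ∘ suc) j

    extendByZero-inject≤ : ∀ {a b} (a≤b : a ≤ℕ b) d (i : Fin a) → extendByZero a≤b d (inject≤ i a≤b) ≡ d i
    extendByZero-inject≤ (s≤s a≤b) d zero    = refl
    extendByZero-inject≤ (s≤s a≤b) d (suc i) = extendByZero-inject≤ a≤b (d ∘ suc) i

    ∑-extendByZero : ∀ {a b} (a≤b : a ≤ℕ b) d (f : Fin b → Carrier) →
      ∑ L (λ j → ι (extendByZero a≤b d j) * f j) ≡ ∑ L (λ i → ι (d i) * f (inject≤ i a≤b))
    ∑-extendByZero z≤n       d f = ∑-zero (λ j → ι-0-* (f j))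
    ∑-extendByZero (s≤s a≤b) d f = cong (ι (d zero) * f zero +_) (∑-extendByZero a≤b (d ∘ suc) (f ∘ suc))

    basis-prefix-independent : ∀ {ρ} (ρ≤m : ρ ≤ℕ m) d →
      ∑ L (λ a → ι (d a) * basis (inject≤ a ρ≤m)) ≡ 0# → ∀ a → d a ≡ F.0#
    basis-prefix-independent ρ≤m d relation a = begin
      d a                                   ≡⟨ extendByZero-inject≤ ρ≤m d a ⟨
      extendByZero ρ≤m d (inject≤ a ρ≤m)    ≡⟨ basis-independent (extendByZero ρ≤m d)
                                                 (trans (∑-extendByZero ρ≤m d basis) relation) (inject≤ a ρ≤m) ⟩
      F.0#                                  ∎

    module BlockSystem {k ρ : ℕ} (ρ≤k : ρ ≤ℕ k) (G' : Mat L (k ∸ ρ) (m *ℕ (k ∸ ρ)))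
                       (G'-independent : ColsFIndep E G') where
      open RowSplit ρ≤k

      N : ℕ
      N = m *ℕ (k ∸ ρ)

      G : Mat L k (ρ +ℕ N)
      G = blockG E m ρ≤k G'

      blockEntry : Fin ρ ⊎ Fin (k ∸ ρ) → Fin ρ ⊎ Fin N → Carrier
      blockEntry (inj₁ a) (inj₁ b) = idEntry E a b
      blockEntry (inj₁ a) (inj₂ c) = 0#
      blockEntry (inj₂ c) (inj₁ b) = 0#
      blockEntry (inj₂ c) (inj₂ j) = G' c j

      G≡blockEntry : ∀ i j → G i j ≡ blockEntry (split i) (splitAt ρ j)
      G≡blockEntry i j with split i | splitAt ρ j
      ... | inj₁ a | inj₁ b = refl
      ... | inj₁ a | inj₂ c = refl
      ... | inj₂ c | inj₁ b = refl
      ... | inj₂ c | inj₂ j = refl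

      entry : ∀ {i j x y} → split i ≡ x → splitAt ρ j ≡ y → G i j ≡ blockEntry x y
      entry {i} {j} refl refl = G≡blockEntry i j

      combination-upper : ∀ (μ : Fin (ρ +ℕ N) → Carrier) a → ∑ L (λ j → μ j * G (upper a) j) ≡ μ (a ↑ˡ N)
      combination-upper μ a = begin
        ∑ L (λ j → μ j * G (upper a) j)                       ≡⟨ ∑-↑ {ρ} {N} _ ⟩
        ∑ L (λ b → μ (b ↑ˡ N) * G (upper a) (b ↑ˡ N)) +
        ∑ L (λ c → μ (ρ ↑ʳ c) * G (upper a) (ρ ↑ʳ c))         ≡⟨ cong₂ _+_
            (∑-cong (λ b → cong (μ (b ↑ˡ N) *_) (entry (split-upper a) (splitAt-↑ˡ ρ b N))))
            (∑-zero (λ c → trans (cong (μ (ρ ↑ʳ c) *_) (entry (split-upper a) (splitAt-↑ʳ ρ N c))) (zeroʳ _))) ⟩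
        ∑ L (λ b → μ (b ↑ˡ N) * idEntry E a b) + 0#           ≡⟨ +-identityʳ _ ⟩
        ∑ L (λ b → μ (b ↑ˡ N) * idEntry E a b)                ≡⟨ ∑-idEntry (λ b → μ (b ↑ˡ N)) a ⟩
        μ (a ↑ˡ N)                                            ∎

      combination-lower : ∀ (μ : Fin (ρ +ℕ N) → Carrier) c →
        ∑ L (λ j → μ j * G (lower c) j) ≡ ∑ L (λ j → μ (ρ ↑ʳ j) * G' c j)
      combination-lower μ c = begin
        ∑ L (λ j → μ j * G (lower c) j)                       ≡⟨ ∑-↑ {ρ} {N} _ ⟩
        ∑ L (λ b → μ (b ↑ˡ N) * G (lower c) (b ↑ˡ N)) +
        ∑ L (λ j → μ (ρ ↑ʳ j) * G (lower c) (ρ ↑ʳ j))         ≡⟨ cong₂ _+_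
            (∑-zero (λ b → trans (cong (μ (b ↑ˡ N) *_) (entry (split-lower c) (splitAt-↑ˡ ρ b N))) (zeroʳ _)))
            (∑-cong (λ j → cong (μ (ρ ↑ʳ j) *_) (entry (split-lower c) (splitAt-↑ʳ ρ N j)))) ⟩
        0# + ∑ L (λ j → μ (ρ ↑ʳ j) * G' c j)                  ≡⟨ +-identityˡ _ ⟩
        ∑ L (λ j → μ (ρ ↑ʳ j) * G' c j)                       ∎

      rows⇒combination : ∀ (μ : Fin (ρ +ℕ N) → Carrier) (v : Vect L k) →
        (∀ a → v (upper a) ≡ μ (a ↑ˡ N)) → (∀ c → v (lower c) ≡ ∑ L (λ j → μ (ρ ↑ʳ j) * G' c j)) →
        ∀ r → v r ≡ ∑ L (λ j → μ j * G r j)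
      rows⇒combination μ v v-upper v-lower = row-elim _
        (λ a → trans (v-upper a) (sym (combination-upper μ a)))
        (λ c → trans (v-lower c) (sym (combination-lower μ c)))

      G-independent : ColsFIndep E G
      G-independent λs G·λs≡0 = ↑-elim _
        (λ a → ι-injective₀ (trans (sym (combination-upper (ι ∘ λs) a)) (G·λs≡0 (upper a))))
        (G'-independent (λs ∘ (ρ ↑ʳ_)) (λ c → trans (sym (combination-lower (ι ∘ λs) c)) (G·λs≡0 (lower c))))

      G-spans : LSpans E G
      G-spans v with independent⇒spanning G' G'-independent (v ∘ lower)
      ... | b , v-lower = μ , rows⇒combination μ v
          (λ a → sym (lookup-++ˡ (v ∘ upper) (ι ∘ b) a))
          (λ c → trans (v-lower c) (∑-cong (λ j → cong (_* G' c j) (sym (lookup-++ʳ (v ∘ upper) (ι ∘ b) j)))))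
        where
        μ : Fin (ρ +ℕ N) → Carrier
        μ = (v ∘ upper) ++ (ι ∘ b)

      rationalUpper⇒InU : (x : Fin ρ → F.Carrier) (u : Vect L k) → (∀ a → u (upper a) ≡ ι (x a)) → InU E G u
      rationalUpper⇒InU x u u-upper with independent⇒spanning G' G'-independent (u ∘ lower)
      ... | b , u-lower = x ++ b , rows⇒combination (ι ∘ (x ++ b)) u
          (λ a → trans (u-upper a) (cong ι (sym (lookup-++ˡ x b a))))
          (λ c → trans (u-lower c) (∑-cong (λ j → cong (λ y → ι y * G' c j) (sym (lookup-++ʳ x b j)))))

      pivot⇒coveredBy : ∀ v a₀ → v (upper a₀) ≢ 0# → CoveredBy G ρ v
      pivot⇒coveredBy v a₀ v₀≢0 with inverse (v (upper a₀)) v₀≢0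
      ... | y , v₀y≡1 = u , (λ i → u∈U i , u≢0 i) , v ∘ upper , row-elim _ v-upper v-lower
        where
        u : Fin ρ → Vect L k
        u i = glue (λ a → idEntry E a i) (λ c → y * v (lower c) * idEntry E a₀ i)

        u∈U : ∀ i → InU E G (u i)
        u∈U i = rationalUpper⇒InU (λ a → δ a i) (u i) (λ a → trans (glue-upper _ _ a) (sym (ι-δ a i)))

        u≢0 : ∀ i → Nonzero L (u i)
        u≢0 i u≡0 = 0≢1 (begin
          0#              ≡⟨ u≡0 (upper i) ⟨
          u i (upper i)   ≡⟨ glue-upper _ _ i ⟩
          idEntry E i i   ≡⟨ idEntry-diag i ⟩
          1#              ∎)

        v-upper : ∀ a → v (upper a) ≡ ∑ L (λ i → v (upper i) * u i (upper a))
        v-upper a = sym (trans (∑-cong (λ i → cong (v (upper i) *_) (glue-upper _ _ a))) (∑-idEntry (v ∘ upper) a))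

        v-lower : ∀ c → v (lower c) ≡ ∑ L (λ i → v (upper i) * u i (lower c))
        v-lower c = sym (begin
          ∑ L (λ i → v (upper i) * u i (lower c))    ≡⟨ ∑-cong (λ i → trans (cong (v (upper i) *_) (glue-lower _ _ c))
                                                                            (sym (*-assoc _ _ _))) ⟩
          ∑ L (λ i → w i * idEntry E a₀ i)           ≡⟨ ∑-idEntry w a₀ ⟩
          v (upper a₀) * (y * v (lower c))           ≡⟨ *-assoc _ _ _ ⟨
          v (upper a₀) * y * v (lower c)             ≡⟨ cong (_* v (lower c)) v₀y≡1 ⟩
          1# * v (lower c)                           ≡⟨ *-identityˡ _ ⟩
          v (lower c)                                ∎)
          where
          w : Fin ρ → Carrier
          w i = v (upper i) * (y * v (lower c))

      G-covered : Fin ρ → Covered E G ρ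
      G-covered i₀ v v≢0 with all? (λ a → v (upper a) ≟0)
      ... | no  ¬upper≡0 = let a₀ , v₀≢0 = ¬∀⟶∃¬ ρ _ (λ a → v (upper a) ≟0) ¬upper≡0 in pivot⇒coveredBy v a₀ v₀≢0
      ... | yes upper≡0  = InU⇒coveredBy i₀ (rationalUpper⇒InU (λ _ → F.0#) v (λ a → trans (upper≡0 a) (sym ι-0))) v≢0

      coveredBy⇒upper-rational : ∀ {s v} → CoveredBy G s v →
        ∃₂ λ (A : Fin s → Fin ρ → F.Carrier) (μ : Fin s → Carrier) → ∀ a → v (upper a) ≡ ∑ L (λ i → μ i * ι (A i a))
      coveredBy⇒upper-rational (u , u∈U , μ , v≡μu) = (λ i a → proj₁ (proj₁ (u∈U i)) (a ↑ˡ N)) , μ , λ a →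
        trans (v≡μu (upper a)) (∑-cong (λ i → cong (μ i *_)
          (trans (proj₂ (proj₁ (u∈U i)) (upper a)) (combination-upper (ι ∘ proj₁ (proj₁ (u∈U i))) a))))

      module _ (ρ≤m : ρ ≤ℕ m) where
        basisPoint : Vect L k
        basisPoint = glue (λ a → basis (inject≤ a ρ≤m)) (λ _ → 0#)

        basisPoint≢0 : Fin ρ → Nonzero L basisPoint
        basisPoint≢0 a₀ basisPoint≡0 = F.0≢1 (sym (basis-prefix-independent ρ≤m (λ _ → F.1#)
          (∑-zero (λ a → trans (cong (ι F.1# *_) (trans (sym (glue-upper _ _ a)) (basisPoint≡0 (upper a)))) (zeroʳ _)))
          a₀))

        G-not-covered : ∀ {s} → s <ℕ ρ → ¬ Covered E G s
        G-not-covered s<ρ covered with coveredBy⇒upper-rational (covered basisPoint (basisPoint≢0 (fromℕ< s<ρ)))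
        ... | A , μ , upper≡μA with spannedByFewer⇒dependent s<ρ A μ _ (λ a → trans (sym (glue-upper _ _ a)) (upper≡μA a))
        ...   | d , d≢0 , relation = d≢0 (basis-prefix-independent ρ≤m d relation)

open import Data.Nat using (_≤_; _+_; _*_)

theorem3p4 : (E : Extension) (q m k ρ : ℕ) →
    IsPrimePower q → Fin q ↔ Field.Carrier (Extension.Fq E) →
    1 ≤ m → HasDegree E m → 1 ≤ k →
    1 ≤ ρ → (ρ≤k : ρ ≤ k) → ρ ≤ m →
    (G' : Mat (Extension.L E) (k ∸ ρ) (m * (k ∸ ρ))) → ColsFIndep E G' →
    RankSaturating E (blockG E m ρ≤k G') ρ × sLe E k ρ (m * (k ∸ ρ) + ρ)
-- Finiteness of F_q enters only through the enumeration.
theorem3p4 E q m k .(suc r) _ enum _ hd _ (s≤s {n = r} z≤n) ρ≤k ρ≤m G' G'-independent =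
  G-rank-saturating , _ , ≤-reflexive (+-comm (suc r) _) , G , (G-independent , G-spans) , G-rank-saturating
  where
  open FiniteExtension E enum
  open Coordinates hd
  open BlockSystem ρ≤k G' G'-independent

  G-rank-saturating : RankSaturating E G (suc r)
  G-rank-saturating = r , refl , G-covered zero , λ r' r'<r → G-not-covered ρ≤m (s≤s r'<r)
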